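{- If $(\mathsf{e},\gamma)$ and $(\mathsf{e}',\gamma')$ are actual events with $\mathsf{e}\wedge\mathsf{e}'=\bot$, then, setting $\eta:=\lambda n.(\gamma(2n)+\gamma'(2n))$, the pair $(\mathsf{e}\vee\mathsf{e}',\eta)$ is an actual event.
   Context: A potential event is a sequence $\mathsf{e}:\mathbb{N}^{+}\to\{0,1\}$ (extensional equality); $\bot=\lambda n.0$, $(\mathsf{e}\wedge\mathsf{e}')(n)=\mathsf{e}(n)\mathsf{e}'(n)$, $(\mathsf{e}\vee\mathsf{e}')(n)=\mathsf{e}(n)+\mathsf{e}'(n)-\mathsf{e}(n)\mathsf{e}'(n)$. Define $\Phi(\mathsf{e})(n)=\frac{\sum_{i=1}^{n}\mathsf{e}(i)}{n}$. An actual event is a pair $(\mathsf{e},\gamma)$ with $\gamma:\mathbb{N}^{+}\to\mathbb{N}^{+}$ strictly increasing and $|\Phi(\mathsf{e})(\gamma(n)+i)-\Phi(\mathsf{e})(\gamma(n)+j)|\le\frac1n$ for all $n\in\mathbb{N}^{+}$, $i,j\in\mathbb{N}$. -}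

module Defs where

open import Data.Bool using (Bool; true; false; _∧_; _∨_)
open import Data.Nat using (ℕ; zero; suc; _+_; _*_; _<_; _≤_)
open import Data.Integer using (+_)
open import Data.Rational using (ℚ; 0ℚ; _/_; ∣_∣; _-_) renaming (_≤_ to _≤ℚ_)
open import Data.Product using (_×_)
open import Relation.Binary.PropositionalEquality using (_≡_)

-- A potential event: a {0,1}-valued sequence, encoded as ℕ → Bool
-- (true = 1, false = 0).  Only the values at positive indices n ≥ 1
-- are meaningful; the value at 0 is ignored everywhere.
PEvent : Set
PEvent = ℕ → Bool

bit : Bool → ℕ
bit true  = 1
bit false = 0

⊥ₑ : PEvent
⊥ₑ = λ _ → false

-- pointwise meet and join (on {0,1}: e·e' and e + e' - e·e')
_∧ₑ_ : PEvent → PEvent → PEvent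
(e ∧ₑ e') n = e n ∧ e' n

_∨ₑ_ : PEvent → PEvent → PEvent
(e ∨ₑ e') n = e n ∨ e' n

_≐_ : PEvent → PEvent → Set
e ≐ e' = ∀ m → e (suc m) ≡ e' (suc m)

count : PEvent → ℕ → ℕ
count e zero    = 0
count e (suc n) = count e n + bit (e (suc n))

-- Φ(e)(n) = (Σ_{i=1}^n e(i)) / n  for n ≥ 1; Φ(e)(0) is a junk value 0.
Φ : PEvent → ℕ → ℚ
Φ e zero    = 0ℚ
Φ e (suc n) = (+ count e (suc n)) / suc n

-- γ : ℕ⁺ → ℕ⁺ strictly increasing (γ encoded as ℕ → ℕ, only used on suc m)
PosValued : (ℕ → ℕ) → Set
PosValued γ = ∀ m → 1 ≤ γ (suc m)

StrictlyIncreasing : (ℕ → ℕ) → Set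
StrictlyIncreasing γ = ∀ m k → m < k → γ (suc m) < γ (suc k)

ActualEvent : PEvent → (ℕ → ℕ) → Set
ActualEvent e γ =
  PosValued γ × StrictlyIncreasing γ ×
  (∀ m i j → ∣ Φ e (γ (suc m) + i) - Φ e (γ (suc m) + j) ∣ ≤ℚ (+ 1) / suc m)

-- Disjointness makes Φ additive: Φ (e ∨ e') = Φ e + Φ e'.  Past η(n) = γ(2n) + γ'(2n)
-- both Φ e and Φ e' oscillate by at most 1/(2n), since η(n) lies beyond γ(2n) and
-- γ'(2n); by the triangle inequality their sum oscillates by at most 1/(2n) + 1/(2n) = 1/n.
module Submission where

open import Defs
open import Data.Nat using (ℕ; _+_; _*_)

open import Data.Bool using (true; false) renaming (_∧_ to _∧ᵇ_; _∨_ to _∨ᵇ_)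
open import Data.Integer as ℤ using (+_)
open import Data.Nat as ℕ using (suc)
open import Data.Nat.Properties as ℕ using (m≤n⇒∃[o]m+o≡n)
open import Algebra.Properties.CommutativeSemigroup ℕ.+-commutativeSemigroup
  using (interchange)
import Data.Integer.Properties as ℤ
open import Data.Product using (_,_)
open import Data.Rational as ℚ using (ℚ; fromℚᵘ; toℚᵘ)
open import Data.Rational.Properties as ℚ
  using (toℚᵘ-injective; toℚᵘ-homo-+; toℚᵘ-fromℚᵘ; fromℚᵘ-cong)
open import Data.Rational.Solver using (module +-*-Solver)
import Data.Rational.Unnormalised as ℚᵘ
import Data.Rational.Unnormalised.Properties as ℚᵘ
open import Relation.Binary.PropositionalEquality

bit-∨-disjoint : ∀ a b → a ∧ᵇ b ≡ false → bit (a ∨ᵇ b) ≡ bit a + bit b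
bit-∨-disjoint true  false _ = refl
bit-∨-disjoint false true  _ = refl
bit-∨-disjoint false false _ = refl

count-∨-disjoint : ∀ e e' → (e ∧ₑ e') ≐ ⊥ₑ →
                   ∀ n → count (e ∨ₑ e') n ≡ count e n + count e' n
count-∨-disjoint e e' disj ℕ.zero    = refl
count-∨-disjoint e e' disj (suc n) = begin
  count (e ∨ₑ e') n + bit (e (suc n) ∨ᵇ e' (suc n))
    ≡⟨ cong₂ _+_ (count-∨-disjoint e e' disj n)
                 (bit-∨-disjoint (e (suc n)) (e' (suc n)) (disj n)) ⟩
  (count e n + count e' n) + (bit (e (suc n)) + bit (e' (suc n)))
    ≡⟨ interchange (count e n) (count e' n) (bit (e (suc n))) (bit (e' (suc n))) ⟩
  (count e n + bit (e (suc n))) + (count e' n + bit (e' (suc n))) ∎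
  where open ≡-Reasoning

fromℚᵘ-homo-+ : ∀ p q → fromℚᵘ (p ℚᵘ.+ q) ≡ fromℚᵘ p ℚ.+ fromℚᵘ q
fromℚᵘ-homo-+ p q = toℚᵘ-injective (begin
  toℚᵘ (fromℚᵘ (p ℚᵘ.+ q))           ≈⟨ toℚᵘ-fromℚᵘ (p ℚᵘ.+ q) ⟩
  p ℚᵘ.+ q                            ≈⟨ ℚᵘ.+-cong (toℚᵘ-fromℚᵘ p) (toℚᵘ-fromℚᵘ q) ⟨
  toℚᵘ (fromℚᵘ p) ℚᵘ.+ toℚᵘ (fromℚᵘ q) ≈⟨ toℚᵘ-homo-+ (fromℚᵘ p) (fromℚᵘ q) ⟨
  toℚᵘ (fromℚᵘ p ℚ.+ fromℚᵘ q)        ∎)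
  where open ℚᵘ.≃-Reasoning

/-distribʳ-+ : ∀ i j k → (i ℤ.+ j) ℚ./ suc k ≡ i ℚ./ suc k ℚ.+ j ℚ./ suc k
/-distribʳ-+ i j k =
  trans (fromℚᵘ-cong {ℚᵘ.mkℚᵘ (i ℤ.+ j) k} {ℚᵘ.mkℚᵘ i k ℚᵘ.+ ℚᵘ.mkℚᵘ j k}
                     (ℚᵘ.*≡* same-denominator))
        (fromℚᵘ-homo-+ (ℚᵘ.mkℚᵘ i k) (ℚᵘ.mkℚᵘ j k))
  where
  d = + suc k
  same-denominator : (i ℤ.+ j) ℤ.* + (suc k ℕ.* suc k) ≡ (i ℤ.* d ℤ.+ j ℤ.* d) ℤ.* d
  same-denominator = begin
    (i ℤ.+ j) ℤ.* + (suc k ℕ.* suc k) ≡⟨ cong ((i ℤ.+ j) ℤ.*_) (ℤ.pos-* (suc k) (suc k)) ⟩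
    (i ℤ.+ j) ℤ.* (d ℤ.* d)           ≡⟨ ℤ.*-assoc (i ℤ.+ j) d d ⟨
    (i ℤ.+ j) ℤ.* d ℤ.* d             ≡⟨ cong (ℤ._* d) (ℤ.*-distribʳ-+ d i j) ⟩
    (i ℤ.* d ℤ.+ j ℤ.* d) ℤ.* d       ∎
    where open ≡-Reasoning

Φ-∨-disjoint : ∀ e e' → (e ∧ₑ e') ≐ ⊥ₑ → ∀ n → Φ (e ∨ₑ e') n ≡ Φ e n ℚ.+ Φ e' n
Φ-∨-disjoint e e' disj ℕ.zero    = refl
Φ-∨-disjoint e e' disj (suc n) = begin
  + count (e ∨ₑ e') (suc n) ℚ./ suc n
    ≡⟨ cong (λ c → + c ℚ./ suc n) (count-∨-disjoint e e' disj (suc n)) ⟩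
  + (count e (suc n) + count e' (suc n)) ℚ./ suc n
    ≡⟨ /-distribʳ-+ (+ count e (suc n)) (+ count e' (suc n)) n ⟩
  + count e (suc n) ℚ./ suc n ℚ.+ + count e' (suc n) ℚ./ suc n ∎
  where open ≡-Reasoning

half+half : ∀ m → + 1 ℚ./ (2 * suc m) ℚ.+ + 1 ℚ./ (2 * suc m) ≡ + 1 ℚ./ suc m
half+half m = trans (sym (/-distribʳ-+ (+ 1) (+ 1) (ℕ.pred (2 * suc m))))
                    (fromℚᵘ-cong (ℚᵘ.*-cancelˡ-/ 2 {+ 1} {suc m}))

∣[p+q]-[r+s]∣≤∣p-r∣+∣q-s∣ : ∀ p q r s →
  ℚ.∣ (p ℚ.+ q) ℚ.- (r ℚ.+ s) ∣ ℚ.≤ ℚ.∣ p ℚ.- r ∣ ℚ.+ ℚ.∣ q ℚ.- s ∣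
∣[p+q]-[r+s]∣≤∣p-r∣+∣q-s∣ p q r s =
  ℚ.≤-trans (ℚ.≤-reflexive (cong ℚ.∣_∣ (regroup p q r s)))
            (ℚ.∣p+q∣≤∣p∣+∣q∣ (p ℚ.- r) (q ℚ.- s))
  where
  open +-*-Solver
  regroup : ∀ p q r s → (p ℚ.+ q) ℚ.- (r ℚ.+ s) ≡ (p ℚ.- r) ℚ.+ (q ℚ.- s)
  regroup = solve 4 (λ p q r s → (p :+ q) :- (r :+ s) := (p :- r) :+ (q :- s)) refl

-- The last component of ActualEvent e γ is  ∀ m → CauchyFrom (Φ e) (γ (suc m)) (+ 1 / suc m).
CauchyFrom : (ℕ → ℚ) → ℕ → ℚ → Set
CauchyFrom f N ε = ∀ i j → ℚ.∣ f (N + i) ℚ.- f (N + j) ∣ ℚ.≤ ε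

cauchyFrom-mono : ∀ f {N M ε} → N ℕ.≤ M → CauchyFrom f N ε → CauchyFrom f M ε
cauchyFrom-mono f {N} N≤M cauchy i j with k , refl ← m≤n⇒∃[o]m+o≡n N≤M
  rewrite ℕ.+-assoc N k i | ℕ.+-assoc N k j = cauchy (k + i) (k + j)

cauchyFrom-+ : ∀ f g N {ε δ} → CauchyFrom f N ε → CauchyFrom g N δ →
               CauchyFrom (λ n → f n ℚ.+ g n) N (ε ℚ.+ δ)
cauchyFrom-+ f g N cf cg i j =
  ℚ.≤-trans (∣[p+q]-[r+s]∣≤∣p-r∣+∣q-s∣ (f (N + i)) (g (N + i))
                                        (f (N + j)) (g (N + j)))
            (ℚ.+-mono-≤ (cf i j) (cg i j))

cauchyFrom-cong : ∀ {f g} N {ε} → (∀ n → f n ≡ g n) →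
                  CauchyFrom f N ε → CauchyFrom g N ε
cauchyFrom-cong N {ε} f≗g cauchy i j =
  subst₂ (λ x y → ℚ.∣ x ℚ.- y ∣ ℚ.≤ ε) (f≗g (N + i)) (f≗g (N + j)) (cauchy i j)

strictlyIncreasing-+ : ∀ {γ δ} → StrictlyIncreasing γ → StrictlyIncreasing δ →
                       StrictlyIncreasing (λ n → γ n + δ n)
strictlyIncreasing-+ γ↑ δ↑ m k m<k = ℕ.+-mono-< (γ↑ m k m<k) (δ↑ m k m<k)

strictlyIncreasing-∘-double : ∀ {γ} → StrictlyIncreasing γ →
                              StrictlyIncreasing (λ n → γ (2 * n))
strictlyIncreasing-∘-double γ↑ m k m<k =
  γ↑ _ _ (ℕ.s<s⁻¹ (ℕ.*-monoʳ-< 2 (ℕ.s<s m<k)))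

mainTheorem7 : (e e' : PEvent) (γ γ' : ℕ → ℕ) →
    ActualEvent e γ → ActualEvent e' γ' → (e ∧ₑ e') ≐ ⊥ₑ →
    ActualEvent (e ∨ₑ e') (λ n → γ (2 * n) + γ' (2 * n))
mainTheorem7 e e' γ γ' (γ≥1 , γ↑ , e-cauchy) (_ , γ'↑ , e'-cauchy) disj =
  η≥1 , η↑ , η-cauchy
  where
  η : ℕ → ℕ
  η n = γ (2 * n) + γ' (2 * n)

  η≥1 : PosValued η
  η≥1 m = ℕ.≤-trans (γ≥1 _) (ℕ.m≤m+n (γ (2 * suc m)) (γ' (2 * suc m)))

  η↑ : StrictlyIncreasing η
  η↑ = strictlyIncreasing-+ {λ n → γ (2 * n)} {λ n → γ' (2 * n)}
         (strictlyIncreasing-∘-double {γ} γ↑) (strictlyIncreasing-∘-double {γ'} γ'↑)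

  η-cauchy : ∀ m → CauchyFrom (Φ (e ∨ₑ e')) (η (suc m)) (+ 1 ℚ./ suc m)
  η-cauchy m =
    cauchyFrom-cong (η (suc m)) (λ n → sym (Φ-∨-disjoint e e' disj n))
      (subst (CauchyFrom (λ n → Φ e n ℚ.+ Φ e' n) (η (suc m))) (half+half m)
        (cauchyFrom-+ (Φ e) (Φ e') (η (suc m)) e-cauchy-η e'-cauchy-η))
    where
    e-cauchy-η : CauchyFrom (Φ e) (η (suc m)) (+ 1 ℚ./ (2 * suc m))
    e-cauchy-η = cauchyFrom-mono (Φ e) (ℕ.m≤m+n (γ (2 * suc m)) (γ' (2 * suc m)))
                                 (e-cauchy (ℕ.pred (2 * suc m)))
    e'-cauchy-η : CauchyFrom (Φ e') (η (suc m)) (+ 1 ℚ./ (2 * suc m))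
    e'-cauchy-η = cauchyFrom-mono (Φ e') (ℕ.m≤n+m (γ' (2 * suc m)) (γ (2 * suc m)))
                                  (e'-cauchy (ℕ.pred (2 * suc m)))
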